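{- Let $k\ge 2$. The limit $\lim_{n\to\infty} s_k(n)/k^n$ exists and equals a constant $\alpha_k$ satisfying $\alpha_k > 1 - 1/(k-1)$.
   Context: $\Sigma_k=\{0,\ldots,k-1\}$. A square is a nonempty word of the form $xx$. $s_k(n)$ is the number of length-$n$ words over $\Sigma_k$ having no square prefix (no nonempty prefix, possibly the whole word, that is a square). -}

module Defs where

open import Data.Nat using (ℕ; zero; suc; _+_; _^_; _≤_; _<_; s≤s; NonZero)
open import Data.Nat.Properties using (m^n≢0; ≤-trans; ≤-reflexive)
open import Data.Fin using (Fin; toℕ; fromℕ<)
open import Data.Fin.Properties using (any?; toℕ-fromℕ<) renaming (_≟_ to _≟F_)
open import Data.List using (List; []; _∷_; _++_; length; take; drop; map; concatMap; filter; allFin)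
open import Data.List.Properties using (≡-dec; length-++-≤ˡ)
open import Data.Product using (Σ; ∃; _×_; _,_; proj₁; proj₂)
open import Data.Integer using (+_)
open import Data.Rational using (ℚ; _/_)
open import Relation.Nullary using (¬_; Dec; yes; no)
open import Relation.Nullary.Decidable using (¬?; _×-dec_)
open import Relation.Binary.PropositionalEquality using (_≡_; _≢_; refl; sym; trans; cong; subst)

Word : ℕ → Set
Word k = List (Fin k)

allWords : (k n : ℕ) → List (Word k)
allWords k zero    = [] ∷ []
allWords k (suc n) = concatMap (λ a → map (a ∷_) (allWords k n)) (allFin k)

HasSquarePrefix : {k : ℕ} → Word k → Set
HasSquarePrefix w = Σ _ λ x → x ≢ [] × Σ _ λ r → w ≡ x ++ x ++ r

private
  _≟W_ : {k : ℕ} (u v : Word k) → Dec (u ≡ v)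
  _≟W_ = ≡-dec _≟F_

  take-pre : {A : Set} (x r : List A) → take (length x) (x ++ r) ≡ x
  take-pre []      r = refl
  take-pre (a ∷ x) r = cong (a ∷_) (take-pre x r)

  drop-pre : {A : Set} (m : ℕ) (x r : List A) → drop (length x + m) (x ++ r) ≡ drop m r
  drop-pre m []      r = refl
  drop-pre m (a ∷ x) r = drop-pre m x r

  drop-pre0 : {A : Set} (x r : List A) → drop (length x) (x ++ r) ≡ r
  drop-pre0 []      r = refl
  drop-pre0 (a ∷ x) r = drop-pre0 x r

  Cand : {k : ℕ} (w : Word k) → Fin (suc (length w)) → Set
  Cand w i = (take (toℕ i) w ≢ []) × (w ≡ take (toℕ i) w ++ take (toℕ i) w ++ drop (toℕ i + toℕ i) w)

  cand? : {k : ℕ} (w : Word k) (i : Fin (suc (length w))) → Dec (Cand w i)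
  cand? w i = ¬? (take (toℕ i) w ≟W []) ×-dec (w ≟W _)

  sound : {k : ℕ} (w : Word k) → ∃ (Cand w) → HasSquarePrefix w
  sound w (i , nz , eq) = _ , nz , _ , eq

  complete : {k : ℕ} (w : Word k) → HasSquarePrefix w → ∃ (Cand w)
  complete w (x , nz , r , refl) = i , subst Good (sym ti) (nz′ , eq′)
    where
      w′ = x ++ x ++ r
      bound : length x < suc (length w′)
      bound = s≤s (length-++-≤ˡ x)
      i = fromℕ< bound
      ti : toℕ i ≡ length x
      ti = toℕ-fromℕ< bound
      Good : ℕ → Set
      Good m = (take m w′ ≢ []) × (w′ ≡ take m w′ ++ take m w′ ++ drop (m + m) w′)
      eq′ : w′ ≡ take (length x) w′ ++ take (length x) w′ ++ drop (length x + length x) w′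
      eq′ rewrite take-pre x (x ++ r) | drop-pre (length x) x (x ++ r) | drop-pre0 x r = refl
      nz′ : take (length x) w′ ≢ []
      nz′ e = nz (trans (sym (take-pre x (x ++ r))) e)

hasSquarePrefix? : {k : ℕ} (w : Word k) → Dec (HasSquarePrefix w)
hasSquarePrefix? w with any? (cand? w)
... | yes c = yes (sound w c)
... | no ¬c = no (λ h → ¬c (complete w h))

s : (k n : ℕ) → ℕ
s k n = length (filter (λ w → ¬? (hasSquarePrefix? w)) (allWords k n))

ratio : (k : ℕ) → .{{NonZero k}} → ℕ → ℚ
ratio k n = _/_ (+ s k n) (k ^ n) {{m^n≢0 k n}}

-- Write σ n = s k n and r n = σ n / kⁿ. If w is square-prefix-free but w a is not, then w a = x x
-- with x square-prefix-free; hence k σ n − σ (n + 1) counts such squares of length n + 1, which is 0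
-- for odd length and σ m for length 2m. So r is non-increasing, r (2m + 1) = r (2m), and
-- r (2m) − r (2m + 2) ≤ σ (m + 1) / k^(2m+2) ≤ (k − 1) / k^(m+2) for m ≥ 1, since only the words a a
-- of length 2 have a square prefix. Hence the envelope r (2m) − 1 / k^(m+1) is non-decreasing from
-- m = 1 on: beyond 2M all r n lie within 1 / k^(M+1) below r (2M), which gives the Cauchy property,
-- and r n ≥ r 2 − 1 / k² = 1 − 1/k − 1/k² > 1 − 1/(k − 1) for n ≥ 2.
module Submission where

open import Defs

module Combinatorics where

  open import Data.Nat using (ℕ; zero; suc; _+_; _*_; _^_; _≤_; z≤n; s≤s; ⌊_/2⌋)
  open import Data.Nat.Properties
    using (≤-refl; ≤-trans; ≤-reflexive; ≤-antisym; +-assoc; +-suc; +-identityʳ; *-comm; *-identityʳ; *-zeroʳ; *-distribˡ-+;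
           +-mono-≤; +-monoˡ-≤; +-monoʳ-≤; *-monoʳ-≤; suc-injective; 0≢1+n; n≡⌊n+n/2⌋; +-commutativeSemigroup; module ≤-Reasoning)
  open import Algebra.Properties.CommutativeSemigroup +-commutativeSemigroup using () renaming (interchange to +-interchange)
  open import Data.Fin using (Fin) renaming (zero to fzero; suc to fsuc)
  import Data.Fin.Properties as Fin
  open import Data.List using (List; []; _∷_; _++_; _∷ʳ_; [_]; length; take; drop; map; concatMap; filter; allFin; initLast; _∷ʳ′_)
  import Data.List.Properties as List
  open import Data.Bool using (if_then_else_; true; false)
  open import Data.Empty using (⊥-elim)
  open import Data.Product using (Σ; _×_; _,_; proj₁; proj₂)
  open import Function using (_∘_)
  open import Relation.Nullary using (¬_; Dec; yes; no; does)
  open import Relation.Nullary.Decidable using (¬?)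
  open import Relation.Unary using (Decidable)
  open import Relation.Binary.PropositionalEquality using (_≡_; _≢_; refl; sym; trans; cong; cong₂; subst; module ≡-Reasoning)

  χ : {P : Set} → Dec P → ℕ
  χ d = if does d then 1 else 0

  χ-yes : {P : Set} (d : Dec P) → P → χ d ≡ 1
  χ-yes (yes _) _ = refl
  χ-yes (no ¬p) p with () ← ¬p p

  χ-no : {P : Set} (d : Dec P) → ¬ P → χ d ≡ 0
  χ-no (yes p) ¬p with () ← ¬p p
  χ-no (no _)  _  = refl

  χ≤1 : {P : Set} (d : Dec P) → χ d ≤ 1
  χ≤1 (yes _) = s≤s z≤n
  χ≤1 (no _)  = z≤n

  χ-mono : {P Q : Set} → (P → Q) → (d : Dec P) (e : Dec Q) → χ d ≤ χ e
  χ-mono f (yes p) (yes q) = ≤-refl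
  χ-mono f (yes p) (no ¬q) with () ← ¬q (f p)
  χ-mono f (no _)  e       = z≤n

  χ-× : {P Q R : Set} → (P → Q × R) → (Q → R → P) →
        (d : Dec P) (e : Dec Q) (f : Dec R) → χ d ≡ χ e * χ f
  χ-× to from (yes p) (yes q) (yes r) = refl
  χ-× to from (yes p) (no ¬q) f       with () ← ¬q (proj₁ (to p))
  χ-× to from (yes p) (yes q) (no ¬r) with () ← ¬r (proj₂ (to p))
  χ-× to from (no ¬p) (yes q) (yes r) with () ← ¬p (from q r)
  χ-× to from (no ¬p) (yes q) (no ¬r) = refl
  χ-× to from (no ¬p) (no ¬q) f       = refl

  ∑ : {A : Set} → (A → ℕ) → List A → ℕ
  ∑ f []       = 0
  ∑ f (x ∷ xs) = f x + ∑ f xs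

  module _ {A : Set} where

    length-filter≡∑χ : {P : A → Set} (P? : Decidable P) (xs : List A) →
                       length (filter P? xs) ≡ ∑ (χ ∘ P?) xs
    length-filter≡∑χ P? []       = refl
    length-filter≡∑χ P? (x ∷ xs) with does (P? x)
    ... | true  = cong suc (length-filter≡∑χ P? xs)
    ... | false = length-filter≡∑χ P? xs

    ∑-++ : (f : A → ℕ) (xs ys : List A) → ∑ f (xs ++ ys) ≡ ∑ f xs + ∑ f ys
    ∑-++ f []       ys = refl
    ∑-++ f (x ∷ xs) ys = trans (cong (f x +_) (∑-++ f xs ys)) (sym (+-assoc (f x) _ _))

    ∑-cong : {f g : A → ℕ} → (∀ x → f x ≡ g x) → (xs : List A) → ∑ f xs ≡ ∑ g xs
    ∑-cong f≡g []       = refl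
    ∑-cong f≡g (x ∷ xs) = cong₂ _+_ (f≡g x) (∑-cong f≡g xs)

    ∑-mono : {f g : A → ℕ} → (∀ x → f x ≤ g x) → (xs : List A) → ∑ f xs ≤ ∑ g xs
    ∑-mono f≤g []       = z≤n
    ∑-mono f≤g (x ∷ xs) = +-mono-≤ (f≤g x) (∑-mono f≤g xs)

    ∑-+ : (f g : A → ℕ) (xs : List A) → ∑ (λ x → f x + g x) xs ≡ ∑ f xs + ∑ g xs
    ∑-+ f g []       = refl
    ∑-+ f g (x ∷ xs) = trans (cong (f x + g x +_) (∑-+ f g xs)) (+-interchange (f x) (g x) _ _)

    ∑-zero : {f : A → ℕ} → (∀ x → f x ≡ 0) → (xs : List A) → ∑ f xs ≡ 0
    ∑-zero f≡0 []       = refl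
    ∑-zero f≡0 (x ∷ xs) = cong₂ _+_ (f≡0 x) (∑-zero f≡0 xs)

    ∑-map : {B : Set} (f : B → ℕ) (g : A → B) (xs : List A) → ∑ f (map g xs) ≡ ∑ (f ∘ g) xs
    ∑-map f g []       = refl
    ∑-map f g (x ∷ xs) = cong (f (g x) +_) (∑-map f g xs)

    ∑-*ˡ : (c : ℕ) (f : A → ℕ) (xs : List A) → ∑ (λ x → c * f x) xs ≡ c * ∑ f xs
    ∑-*ˡ c f []       = sym (*-zeroʳ c)
    ∑-*ˡ c f (x ∷ xs) = trans (cong (c * f x +_) (∑-*ˡ c f xs)) (sym (*-distribˡ-+ c (f x) _))

    ∑-const : (c : ℕ) (xs : List A) → ∑ (λ _ → c) xs ≡ length xs * c
    ∑-const c []       = refl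
    ∑-const c (x ∷ xs) = cong (c +_) (∑-const c xs)

  ∑Fin : (k : ℕ) → (Fin k → ℕ) → ℕ
  ∑Fin k f = ∑ f (allFin k)

  ∑Fin-const : ∀ k c → ∑Fin k (λ _ → c) ≡ k * c
  ∑Fin-const k c = trans (∑-const c (allFin k)) (cong (_* c) (List.length-tabulate {n = k} (λ a → a)))

  ∑Fin-suc : ∀ {k} (f : Fin (suc k) → ℕ) → ∑Fin (suc k) f ≡ f fzero + ∑Fin k (f ∘ fsuc)
  ∑Fin-suc {k} f = cong (f fzero +_) (trans (cong (∑ f) (sym (List.map-tabulate (λ a → a) fsuc))) (∑-map f fsuc (allFin k)))

  ∑Fin-≟ : ∀ {k} (b : Fin k) → ∑Fin k (λ a → χ (b Fin.≟ a)) ≡ 1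
  ∑Fin-≟ {suc k} fzero    = trans (∑Fin-suc {k} (λ a → χ (fzero Fin.≟ a))) (cong suc (∑-zero (λ a → refl) (allFin k)))
  ∑Fin-≟ {suc k} (fsuc b) = trans (∑Fin-suc (λ a → χ (fsuc b Fin.≟ a))) (∑Fin-≟ b)

  infix 4 _≟_
  _≟_ : {k : ℕ} (u v : Word k) → Dec (u ≡ v)
  _≟_ = List.≡-dec Fin._≟_

  module WordSums (k : ℕ) where

    ∑[_] : ℕ → (Word k → ℕ) → ℕ
    ∑[ n ] f = ∑ f (allWords k n)

    ∑[]-∷ : ∀ n (f : Word k → ℕ) → ∑[ suc n ] f ≡ ∑Fin k (λ a → ∑[ n ] (f ∘ (a ∷_)))
    ∑[]-∷ n f = begin
      ∑ f (concatMap (λ a → map (a ∷_) (allWords k n)) (allFin k))  ≡⟨ ∑-concatMap (allFin k) ⟩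
      ∑Fin k (λ a → ∑ f (map (a ∷_) (allWords k n)))                ≡⟨ ∑-cong (λ a → ∑-map f (a ∷_) (allWords k n)) (allFin k) ⟩
      ∑Fin k (λ a → ∑[ n ] (f ∘ (a ∷_)))                            ∎
      where
      open ≡-Reasoning
      ∑-concatMap : ∀ {g : Fin k → List (Word k)} as → ∑ f (concatMap g as) ≡ ∑ (∑ f ∘ g) as
      ∑-concatMap {g} []       = refl
      ∑-concatMap {g} (a ∷ as) = trans (∑-++ f (g a) _) (cong (_ +_) (∑-concatMap as))

    ∑[]-∷ʳ : ∀ n (f : Word k → ℕ) → ∑[ suc n ] f ≡ ∑[ n ] (λ w → ∑Fin k (λ a → f (w ∷ʳ a)))
    ∑[]-∷ʳ zero    f = trans (∑[]-∷ zero f) (trans (∑-cong (λ a → +-identityʳ _) (allFin k)) (sym (+-identityʳ _)))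
    ∑[]-∷ʳ (suc n) f = begin
      ∑[ suc (suc n) ] f                                           ≡⟨ ∑[]-∷ (suc n) f ⟩
      ∑Fin k (λ a → ∑[ suc n ] (f ∘ (a ∷_)))                       ≡⟨ ∑-cong (λ a → ∑[]-∷ʳ n (f ∘ (a ∷_))) (allFin k) ⟩
      ∑Fin k (λ a → ∑[ n ] (λ w → ∑Fin k (λ b → f (a ∷ w ∷ʳ b))))  ≡⟨ ∑[]-∷ n _ ⟨
      ∑[ suc n ] (λ w → ∑Fin k (λ b → f (w ∷ʳ b)))                 ∎
      where open ≡-Reasoning

    ∑[]-++ : ∀ m n (f : Word k → ℕ) → ∑[ m + n ] f ≡ ∑[ m ] (λ x → ∑[ n ] (λ y → f (x ++ y)))
    ∑[]-++ zero    n f = sym (+-identityʳ _)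
    ∑[]-++ (suc m) n f = begin
      ∑[ suc m + n ] f                                             ≡⟨ ∑[]-∷ (m + n) f ⟩
      ∑Fin k (λ a → ∑[ m + n ] (f ∘ (a ∷_)))                       ≡⟨ ∑-cong (λ a → ∑[]-++ m n (f ∘ (a ∷_))) (allFin k) ⟩
      ∑Fin k (λ a → ∑[ m ] (λ x → ∑[ n ] (λ y → f (a ∷ x ++ y))))  ≡⟨ ∑[]-∷ m _ ⟨
      ∑[ suc m ] (λ x → ∑[ n ] (λ y → f (x ++ y)))                 ∎
      where open ≡-Reasoning

    ∑[]-mono : ∀ n {f g : Word k → ℕ} → (∀ w → length w ≡ n → f w ≤ g w) → ∑[ n ] f ≤ ∑[ n ] g
    ∑[]-mono zero    f≤g = +-monoˡ-≤ 0 (f≤g [] refl)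
    ∑[]-mono (suc n) {f} {g} f≤g rewrite ∑[]-∷ n f | ∑[]-∷ n g =
      ∑-mono (λ a → ∑[]-mono n (λ w |w|≡n → f≤g (a ∷ w) (cong suc |w|≡n))) (allFin k)

    ∑[]-cong : ∀ n {f g : Word k → ℕ} → (∀ w → length w ≡ n → f w ≡ g w) → ∑[ n ] f ≡ ∑[ n ] g
    ∑[]-cong n f≡g = ≤-antisym (∑[]-mono n (λ w |w| → ≤-reflexive (f≡g w |w|)))
                               (∑[]-mono n (λ w |w| → ≤-reflexive (sym (f≡g w |w|))))

    ∑[]-1 : ∀ n → ∑[ n ] (λ _ → 1) ≡ k ^ n
    ∑[]-1 zero    = refl
    ∑[]-1 (suc n) = trans (∑[]-∷ n _) (trans (∑-cong (λ _ → ∑[]-1 n) (allFin k)) (∑Fin-const k (k ^ n)))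

    ∑[]-≟ : ∀ n (x : Word k) → length x ≡ n → ∑[ n ] (λ y → χ (x ≟ y)) ≡ 1
    ∑[]-≟ zero    []      refl = refl
    ∑[]-≟ (suc n) (b ∷ x) refl = begin
      ∑[ suc n ] (λ y → χ (b ∷ x ≟ y))                         ≡⟨ ∑[]-∷ n _ ⟩
      ∑Fin k (λ a → ∑[ n ] (λ y → χ (b ∷ x ≟ a ∷ y)))          ≡⟨ ∑-cong (λ a → ∑-cong (λ y → χ-∷ a y) (allWords k n)) (allFin k) ⟩
      ∑Fin k (λ a → ∑[ n ] (λ y → χ (b Fin.≟ a) * χ (x ≟ y)))  ≡⟨ ∑-cong (λ a → ∑-*ˡ (χ (b Fin.≟ a)) _ (allWords k n)) (allFin k) ⟩
      ∑Fin k (λ a → χ (b Fin.≟ a) * ∑[ n ] (λ y → χ (x ≟ y)))  ≡⟨ ∑-cong (λ a → cong (χ (b Fin.≟ a) *_) (∑[]-≟ n x refl)) (allFin k) ⟩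
      ∑Fin k (λ a → χ (b Fin.≟ a) * 1)                         ≡⟨ ∑-cong (λ a → *-identityʳ _) (allFin k) ⟩
      ∑Fin k (λ a → χ (b Fin.≟ a))                             ≡⟨ ∑Fin-≟ b ⟩
      1                                                        ∎
      where
      open ≡-Reasoning
      χ-∷ : ∀ a y → χ (b ∷ x ≟ a ∷ y) ≡ χ (b Fin.≟ a) * χ (x ≟ y)
      χ-∷ a y = χ-× (λ e → List.∷-injective e) (λ { refl refl → refl }) (b ∷ x ≟ a ∷ y) (b Fin.≟ a) (x ≟ y)

  module _ {A : Set} where

    take-length-++ : (x r : List A) → take (length x) (x ++ r) ≡ x
    take-length-++ []      r = refl
    take-length-++ (a ∷ x) r = cong (a ∷_) (take-length-++ x r)

    drop-length-++ : (x r : List A) → drop (length x) (x ++ r) ≡ r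
    drop-length-++ []      r = refl
    drop-length-++ (a ∷ x) r = drop-length-++ x r

  m+m≢1+[n+n] : ∀ m n → m + m ≢ suc (n + n)
  m+m≢1+[n+n] zero    n       ()
  m+m≢1+[n+n] (suc m) zero    e rewrite +-suc m m with () ← e
  m+m≢1+[n+n] (suc m) (suc n) e rewrite +-suc m m | +-suc n n = m+m≢1+[n+n] m n (suc-injective (suc-injective e))

  module _ {k : ℕ} where

    hasSquarePrefix-++ : (w z : Word k) → HasSquarePrefix w → HasSquarePrefix (w ++ z)
    hasSquarePrefix-++ w z (x , x≢[] , r , refl) =
      x , x≢[] , r ++ z , trans (List.++-assoc x (x ++ r) z) (cong (x ++_) (List.++-assoc x r z))

    square-hasSquarePrefix : (x : Word k) → x ≢ [] → HasSquarePrefix (x ++ x)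
    square-hasSquarePrefix x x≢[] = x , x≢[] , [] , cong (x ++_) (sym (List.++-identityʳ x))

    -- The square prefix cannot lie inside w, so it is all of w ∷ʳ a; a square prefix of x would be one of w.
    ∷ʳ-square : (w : Word k) (a : Fin k) → ¬ HasSquarePrefix w → HasSquarePrefix (w ∷ʳ a) →
                Σ (Word k) λ x → ¬ HasSquarePrefix x × w ∷ʳ a ≡ x ++ x
    ∷ʳ-square w a ¬sp (x , x≢[] , r , eq) with initLast r
    ... | r′ ∷ʳ′ b = ⊥-elim (¬sp (x , x≢[] , r′ , List.∷ʳ-injectiveˡ w (x ++ x ++ r′) w∷ʳa≡xxr′∷ʳb))
      where
      w∷ʳa≡xxr′∷ʳb : w ∷ʳ a ≡ (x ++ x ++ r′) ∷ʳ b
      w∷ʳa≡xxr′∷ʳb = trans eq (trans (cong (x ++_) (sym (List.++-assoc x r′ [ b ]))) (sym (List.++-assoc x (x ++ r′) [ b ])))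
    ... | []       = x , ¬spx , w∷ʳa≡xx
      where
      w∷ʳa≡xx : w ∷ʳ a ≡ x ++ x
      w∷ʳa≡xx = trans eq (cong (x ++_) (List.++-identityʳ x))
      ¬spx : ¬ HasSquarePrefix x
      ¬spx spx with initLast x
      ... | [] = x≢[] refl
      ... | x′ ∷ʳ′ c = ¬sp (subst HasSquarePrefix (sym w≡) (hasSquarePrefix-++ (x′ ∷ʳ c) x′ spx))
        where
        w≡ : w ≡ x′ ∷ʳ c ++ x′
        w≡ = List.∷ʳ-injectiveˡ w _ (trans w∷ʳa≡xx (sym (List.++-assoc (x′ ∷ʳ c) x′ [ c ])))

    spf : Word k → ℕ
    spf w = χ (¬? (hasSquarePrefix? w))

    spfSquare : Word k → ℕ
    spfSquare v = χ (take h v ≟ drop h v) * spf (take h v)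
      where h = ⌊ length v /2⌋

    spf-0 : (w : Word k) → HasSquarePrefix w → spf w ≡ 0
    spf-0 w sp = χ-no (¬? (hasSquarePrefix? w)) (λ ¬sp → ¬sp sp)

    spf-1 : (w : Word k) → ¬ HasSquarePrefix w → spf w ≡ 1
    spf-1 w = χ-yes (¬? (hasSquarePrefix? w))

    spf≤1 : (w : Word k) → spf w ≤ 1
    spf≤1 w = χ≤1 (¬? (hasSquarePrefix? w))

    spf-∷ʳ : (w : Word k) (a : Fin k) → spf (w ∷ʳ a) ≤ spf w
    spf-∷ʳ w a = χ-mono (λ ¬sp sp → ¬sp (hasSquarePrefix-++ w [ a ] sp)) (¬? (hasSquarePrefix? (w ∷ʳ a))) (¬? (hasSquarePrefix? w))

    spfSquare-++ : (x y : Word k) → length x ≡ length y → spfSquare (x ++ y) ≡ χ (x ≟ y) * spf x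
    spfSquare-++ x y |x|≡|y| rewrite List.length-++ x {y} | sym |x|≡|y| | sym (n≡⌊n+n/2⌋ (length x))
      | take-length-++ x y | drop-length-++ x y = refl

    spfSquare-square : (x : Word k) → ¬ HasSquarePrefix x → spfSquare (x ++ x) ≡ 1
    spfSquare-square x ¬sp rewrite spfSquare-++ x x refl | χ-yes (x ≟ x) refl | spf-1 x ¬sp = refl

    spf-∷ʳ-lower : (w : Word k) (a : Fin k) → spf w ≤ spf (w ∷ʳ a) + spfSquare (w ∷ʳ a)
    spf-∷ʳ-lower w a with hasSquarePrefix? w | hasSquarePrefix? (w ∷ʳ a)
    ... | yes _  | _       = z≤n
    ... | no _   | no _    = s≤s z≤n
    ... | no ¬sp | yes sp′ with ∷ʳ-square w a ¬sp sp′
    ... | x , ¬spx , w∷ʳa≡xx rewrite w∷ʳa≡xx | spfSquare-square x ¬spx = ≤-refl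

    spfSquare-odd : ∀ m (v : Word k) → length v ≡ suc (m + m) → spfSquare v ≡ 0
    spfSquare-odd m v |v|≡ = cong (_* spf u) (χ-no (u ≟ drop h v) odd)
      where
      h = ⌊ length v /2⌋
      u = take h v
      odd : u ≢ drop h v
      odd u≡ = m+m≢1+[n+n] (length u) m (begin
        length u + length u     ≡⟨ List.length-++ u ⟨
        length (u ++ u)         ≡⟨ cong (λ z → length (u ++ z)) u≡ ⟩
        length (u ++ drop h v)  ≡⟨ cong length (List.take++drop≡id h v) ⟩
        length v                ≡⟨ |v|≡ ⟩
        suc (m + m)             ∎)
        where open ≡-Reasoning

    spf+spfSquare≤1 : (v : Word k) → v ≢ [] → spf v + spfSquare v ≤ 1
    spf+spfSquare≤1 v v≢[] with take ⌊ length v /2⌋ v ≟ drop ⌊ length v /2⌋ v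
    ... | no _   = ≤-trans (≤-reflexive (+-identityʳ (spf v))) (spf≤1 v)
    ... | yes u≡ = ≤-trans (≤-reflexive (trans (cong (_+ (spf u + 0)) (spf-0 v sp)) (+-identityʳ (spf u)))) (spf≤1 u)
      where
      u = take ⌊ length v /2⌋ v
      v≡uu : v ≡ u ++ u
      v≡uu = trans (sym (List.take++drop≡id ⌊ length v /2⌋ v)) (cong (u ++_) (sym u≡))
      sp : HasSquarePrefix v
      sp = subst HasSquarePrefix (sym v≡uu) (square-hasSquarePrefix u (λ u≡[] → v≢[] (trans v≡uu (cong (λ z → z ++ z) u≡[]))))

  module _ (k : ℕ) where

    open WordSums k

    spfSquares : ℕ → ℕ
    spfSquares n = ∑[ n ] spfSquare

    s≡∑spf : ∀ n → s k n ≡ ∑[ n ] spf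
    s≡∑spf n = length-filter≡∑χ (λ w → ¬? (hasSquarePrefix? w)) (allWords k n)

    s-suc≤ : ∀ n → s k (suc n) ≤ k * s k n
    s-suc≤ n = begin
      s k (suc n)                                 ≡⟨ s≡∑spf (suc n) ⟩
      ∑[ suc n ] spf                              ≡⟨ ∑[]-∷ʳ n spf ⟩
      ∑[ n ] (λ w → ∑Fin k (λ a → spf (w ∷ʳ a)))  ≤⟨ ∑[]-mono n (λ w _ → ∑-mono (spf-∷ʳ w) (allFin k)) ⟩
      ∑[ n ] (λ w → ∑Fin k (λ _ → spf w))         ≡⟨ ∑-cong (λ w → ∑Fin-const k (spf w)) (allWords k n) ⟩
      ∑[ n ] (λ w → k * spf w)                    ≡⟨ ∑-*ˡ k spf (allWords k n) ⟩
      k * ∑[ n ] spf                              ≡⟨ cong (k *_) (s≡∑spf n) ⟨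
      k * s k n                                   ∎
      where open ≤-Reasoning

    *s≤s-suc+spfSquares : ∀ n → k * s k n ≤ s k (suc n) + spfSquares (suc n)
    *s≤s-suc+spfSquares n = begin
      k * s k n                                                        ≡⟨ cong (k *_) (s≡∑spf n) ⟩
      k * ∑[ n ] spf                                                   ≡⟨ ∑-*ˡ k spf (allWords k n) ⟨
      ∑[ n ] (λ w → k * spf w)                                         ≡⟨ ∑-cong (λ w → ∑Fin-const k (spf w)) (allWords k n) ⟨
      ∑[ n ] (λ w → ∑Fin k (λ _ → spf w))                              ≤⟨ ∑[]-mono n (λ w _ → ∑-mono (spf-∷ʳ-lower w) (allFin k)) ⟩
      ∑[ n ] (λ w → ∑Fin k (λ a → spf (w ∷ʳ a) + spfSquare (w ∷ʳ a)))  ≡⟨ ∑[]-∷ʳ n (λ v → spf v + spfSquare v) ⟨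
      ∑[ suc n ] (λ v → spf v + spfSquare v)                           ≡⟨ ∑-+ spf spfSquare (allWords k (suc n)) ⟩
      ∑[ suc n ] spf + spfSquares (suc n)                              ≡⟨ cong (_+ spfSquares (suc n)) (s≡∑spf (suc n)) ⟨
      s k (suc n) + spfSquares (suc n)                                 ∎
      where open ≤-Reasoning

    spfSquares-odd : ∀ m → spfSquares (suc (m + m)) ≡ 0
    spfSquares-odd m = trans (∑[]-cong (suc (m + m)) (spfSquare-odd m)) (∑-zero (λ _ → refl) (allWords k (suc (m + m))))

    spfSquares-double : ∀ m → spfSquares (m + m) ≡ s k m
    spfSquares-double m = begin
      spfSquares (m + m)                                ≡⟨ ∑[]-++ m m spfSquare ⟩
      ∑[ m ] (λ x → ∑[ m ] (λ y → spfSquare (x ++ y)))  ≡⟨ ∑[]-cong m (λ x |x| → ∑[]-cong m (λ y |y| → spfSquare-++ x y (trans |x| (sym |y|)))) ⟩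
      ∑[ m ] (λ x → ∑[ m ] (λ y → χ (x ≟ y) * spf x))   ≡⟨ ∑-cong (λ x → ∑-cong (λ y → *-comm (χ (x ≟ y)) (spf x)) (allWords k m)) (allWords k m) ⟩
      ∑[ m ] (λ x → ∑[ m ] (λ y → spf x * χ (x ≟ y)))   ≡⟨ ∑-cong (λ x → ∑-*ˡ (spf x) _ (allWords k m)) (allWords k m) ⟩
      ∑[ m ] (λ x → spf x * ∑[ m ] (λ y → χ (x ≟ y)))   ≡⟨ ∑[]-cong m (λ x |x| → cong (spf x *_) (∑[]-≟ m x |x|)) ⟩
      ∑[ m ] (λ x → spf x * 1)                          ≡⟨ ∑-cong (λ x → *-identityʳ (spf x)) (allWords k m) ⟩
      ∑[ m ] spf                                        ≡⟨ s≡∑spf m ⟨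
      s k m                                             ∎
      where open ≡-Reasoning

    s+spfSquares≤ : ∀ n → s k (suc n) + spfSquares (suc n) ≤ k ^ suc n
    s+spfSquares≤ n = begin
      s k (suc n) + spfSquares (suc n)        ≡⟨ cong (_+ spfSquares (suc n)) (s≡∑spf (suc n)) ⟩
      ∑[ suc n ] spf + ∑[ suc n ] spfSquare   ≡⟨ ∑-+ spf spfSquare (allWords k (suc n)) ⟨
      ∑[ suc n ] (λ v → spf v + spfSquare v)  ≤⟨ ∑[]-mono (suc n) (λ v |v| → spf+spfSquare≤1 v (λ v≡[] → 0≢1+n (trans (cong length (sym v≡[])) |v|))) ⟩
      ∑[ suc n ] (λ _ → 1)                    ≡⟨ ∑[]-1 (suc n) ⟩
      k ^ suc n                               ∎
      where open ≤-Reasoning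

    s-one : s k 1 ≡ k
    s-one = ≤-antisym (≤-trans (s-suc≤ 0) (≤-reflexive (*-identityʳ k)))
      (begin
        k                     ≡⟨ *-identityʳ k ⟨
        k * s k 0             ≤⟨ *s≤s-suc+spfSquares 0 ⟩
        s k 1 + spfSquares 1  ≡⟨ cong (s k 1 +_) (spfSquares-odd 0) ⟩
        s k 1 + 0             ≡⟨ +-identityʳ (s k 1) ⟩
        s k 1                 ∎)
      where open ≤-Reasoning

    *s≤s-odd : ∀ m → k * s k (m + m) ≤ s k (suc (m + m))
    *s≤s-odd m = begin
      k * s k (m + m)                               ≤⟨ *s≤s-suc+spfSquares (m + m) ⟩
      s k (suc (m + m)) + spfSquares (suc (m + m))  ≡⟨ cong (s k (suc (m + m)) +_) (spfSquares-odd m) ⟩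
      s k (suc (m + m)) + 0                         ≡⟨ +-identityʳ _ ⟩
      s k (suc (m + m))                             ∎
      where open ≤-Reasoning

    k²s≤s+s : ∀ m → k * (k * s k (m + m)) ≤ s k (suc m + suc m) + s k (suc m)
    k²s≤s+s m = begin
      k * (k * s k (m + m))                             ≤⟨ *-monoʳ-≤ k (*s≤s-odd m) ⟩
      k * s k (suc (m + m))                             ≤⟨ *s≤s-suc+spfSquares (suc (m + m)) ⟩
      s k (2+2m) + spfSquares (2+2m)                    ≡⟨ cong (λ n → s k n + spfSquares n) (sym (+-suc (suc m) m)) ⟩
      s k (suc m + suc m) + spfSquares (suc m + suc m)  ≡⟨ cong (s k (suc m + suc m) +_) (spfSquares-double (suc m)) ⟩
      s k (suc m + suc m) + s k (suc m)                 ∎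
      where
      open ≤-Reasoning
      2+2m = suc (suc (m + m))

    s₂+k≡k*k : s k 2 + k ≡ k * k
    s₂+k≡k*k = ≤-antisym
      (begin
        s k 2 + k             ≡⟨ cong (s k 2 +_) (trans (sym s-one) (sym (spfSquares-double 1))) ⟩
        s k 2 + spfSquares 2  ≤⟨ s+spfSquares≤ 1 ⟩
        k * (k * 1)           ≡⟨ cong (k *_) (*-identityʳ k) ⟩
        k * k                 ∎)
      (begin
        k * k                 ≡⟨ cong (k *_) s-one ⟨
        k * s k 1             ≤⟨ *s≤s-suc+spfSquares 1 ⟩
        s k 2 + spfSquares 2  ≡⟨ cong (s k 2 +_) (trans (spfSquares-double 1) s-one) ⟩
        s k 2 + k             ∎)
      where open ≤-Reasoning

    s+k^≤k^ : ∀ n → s k (2 + n) + k ^ suc n ≤ k ^ (2 + n)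
    s+k^≤k^ zero    = ≤-reflexive (trans (cong (s k 2 +_) (*-identityʳ k)) (trans s₂+k≡k*k (cong (k *_) (sym (*-identityʳ k)))))
    s+k^≤k^ (suc n) = begin
      s k (3 + n) + k * k ^ suc n      ≤⟨ +-monoˡ-≤ _ (s-suc≤ (2 + n)) ⟩
      k * s k (2 + n) + k * k ^ suc n  ≡⟨ *-distribˡ-+ k (s k (2 + n)) _ ⟨
      k * (s k (2 + n) + k ^ suc n)    ≤⟨ *-monoʳ-≤ k (s+k^≤k^ n) ⟩
      k * k ^ (2 + n)                  ∎
      where open ≤-Reasoning

    envelope-step-ℕ : ∀ m → k * (k * s k (suc m + suc m)) + k ^ suc m ≤ s k (2 + m + (2 + m)) + k ^ (2 + m)
    envelope-step-ℕ m = begin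
      k * (k * s k (suc m + suc m)) + k ^ suc m          ≤⟨ +-monoˡ-≤ _ (k²s≤s+s (suc m)) ⟩
      s k (2 + m + (2 + m)) + s k (2 + m) + k ^ suc m    ≡⟨ +-assoc (s k (2 + m + (2 + m))) _ _ ⟩
      s k (2 + m + (2 + m)) + (s k (2 + m) + k ^ suc m)  ≤⟨ +-monoʳ-≤ _ (s+k^≤k^ m) ⟩
      s k (2 + m + (2 + m)) + k ^ (2 + m)                ∎
      where open ≤-Reasoning

module Rationals where

  open import Data.Nat as ℕ using (ℕ; suc; NonZero; _≤′_; ≤′-refl; ≤′-step)
  import Data.Nat.Properties as ℕ
  open import Data.Integer as ℤ using (+_)
  import Data.Integer.Properties as ℤ
  open import Data.Rational using (ℚ; 0ℚ; _/_; _+_; _-_; -_; _≤_; _<_; ∣_∣; toℚᵘ)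
  open import Data.Rational.Properties
    using (≤-refl; ≤-trans; ≤-reflexive; +-mono-≤; +-monoˡ-≤; +-monoʳ-≤; +-monoˡ-<; +-identityʳ; neg-antimono-≤; ∣p∣≡p∨∣p∣≡-p;
           toℚᵘ-fromℚᵘ; toℚᵘ-injective; toℚᵘ-cancel-≤; toℚᵘ-cancel-<; toℚᵘ-homo-+)
  open import Data.Rational.Solver using (module +-*-Solver)
  open import Data.Rational.Unnormalised as ℚᵘ using (mkℚᵘ; *≤*; *<*) renaming (_≃_ to _≃ᵘ_; _/_ to _/ᵘ_)
  import Data.Rational.Unnormalised.Properties as ℚᵘ
  open import Data.Sum using (inj₁; inj₂)
  open import Relation.Binary.PropositionalEquality using (_≡_; refl; sym; trans; cong; cong₂; subst; subst₂)

  toℚᵘ-/ : ∀ a b .{{_ : NonZero b}} → toℚᵘ (+ a / b) ≃ᵘ + a /ᵘ b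
  toℚᵘ-/ a (suc b) = toℚᵘ-fromℚᵘ (mkℚᵘ (+ a) b)

  /ᵘ-≤ : ∀ a b c d .{{_ : NonZero b}} .{{_ : NonZero d}} → a ℕ.* d ℕ.≤ c ℕ.* b → + a /ᵘ b ℚᵘ.≤ + c /ᵘ d
  /ᵘ-≤ a (suc b) c (suc d) ad≤cb = *≤* (subst₂ ℤ._≤_ (ℤ.pos-* a (suc d)) (ℤ.pos-* c (suc b)) (ℤ.+≤+ ad≤cb))

  /ᵘ-< : ∀ a b c d .{{_ : NonZero b}} .{{_ : NonZero d}} → a ℕ.* d ℕ.< c ℕ.* b → + a /ᵘ b ℚᵘ.< + c /ᵘ d
  /ᵘ-< a (suc b) c (suc d) ad<cb = *<* (subst₂ ℤ._<_ (ℤ.pos-* a (suc d)) (ℤ.pos-* c (suc b)) (ℤ.+<+ ad<cb))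

  /ᵘ-+ : ∀ a b c d .{{_ : NonZero b}} .{{_ : NonZero d}} →
         + a /ᵘ b ℚᵘ.+ + c /ᵘ d ≡ _/ᵘ_ (+ (a ℕ.* d ℕ.+ c ℕ.* b)) (b ℕ.* d) {{ℕ.m*n≢0 b d}}
  /ᵘ-+ a (suc b) c (suc d) = cong (λ n → n /ᵘ (suc b ℕ.* suc d))
    (sym (trans (ℤ.pos-+ (a ℕ.* suc d) (c ℕ.* suc b)) (cong₂ ℤ._+_ (ℤ.pos-* a (suc d)) (ℤ.pos-* c (suc b)))))

  /-mono-≤ : ∀ a b c d .{{_ : NonZero b}} .{{_ : NonZero d}} → a ℕ.* d ℕ.≤ c ℕ.* b → + a / b ≤ + c / d
  /-mono-≤ a b c d ad≤cb =
    toℚᵘ-cancel-≤ (ℚᵘ.≤-respˡ-≃ (ℚᵘ.≃-sym (toℚᵘ-/ a b)) (ℚᵘ.≤-respʳ-≃ (ℚᵘ.≃-sym (toℚᵘ-/ c d)) (/ᵘ-≤ a b c d ad≤cb)))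

  /-mono-< : ∀ a b c d .{{_ : NonZero b}} .{{_ : NonZero d}} → a ℕ.* d ℕ.< c ℕ.* b → + a / b < + c / d
  /-mono-< a b c d ad<cb =
    toℚᵘ-cancel-< (ℚᵘ.<-respˡ-≃ (ℚᵘ.≃-sym (toℚᵘ-/ a b)) (ℚᵘ.<-respʳ-≃ (ℚᵘ.≃-sym (toℚᵘ-/ c d)) (/ᵘ-< a b c d ad<cb)))

  /-+ : ∀ a b c d .{{_ : NonZero b}} .{{_ : NonZero d}} →
        + a / b + + c / d ≡ _/_ (+ (a ℕ.* d ℕ.+ c ℕ.* b)) (b ℕ.* d) {{ℕ.m*n≢0 b d}}
  /-+ a b c d = toℚᵘ-injective (begin
    toℚᵘ (+ a / b + + c / d)            ≈⟨ toℚᵘ-homo-+ (+ a / b) (+ c / d) ⟩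
    toℚᵘ (+ a / b) ℚᵘ.+ toℚᵘ (+ c / d)  ≈⟨ ℚᵘ.+-cong (toℚᵘ-/ a b) (toℚᵘ-/ c d) ⟩
    + a /ᵘ b ℚᵘ.+ + c /ᵘ d              ≡⟨ /ᵘ-+ a b c d ⟩
    + n /ᵘ (b ℕ.* d)                    ≈⟨ toℚᵘ-/ n (b ℕ.* d) ⟨
    toℚᵘ (+ n / (b ℕ.* d))              ∎)
    where
    instance _ = ℕ.m*n≢0 b d
    n = a ℕ.* d ℕ.+ c ℕ.* b
    open ℚᵘ.≃-Reasoning

  /+/-mono-≤ : ∀ a b c d e f g h .{{_ : NonZero b}} .{{_ : NonZero d}} .{{_ : NonZero f}} .{{_ : NonZero h}} →
               (a ℕ.* d ℕ.+ c ℕ.* b) ℕ.* (f ℕ.* h) ℕ.≤ (e ℕ.* h ℕ.+ g ℕ.* f) ℕ.* (b ℕ.* d) →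
               + a / b + + c / d ≤ + e / f + + g / h
  /+/-mono-≤ a b c d e f g h le =
    subst₂ _≤_ (sym (/-+ a b c d)) (sym (/-+ e f g h))
      (/-mono-≤ (a ℕ.* d ℕ.+ c ℕ.* b) (b ℕ.* d) (e ℕ.* h ℕ.+ g ℕ.* f) (f ℕ.* h) {{ℕ.m*n≢0 b d}} {{ℕ.m*n≢0 f h}} le)

  /+/-mono-< : ∀ a b c d e f g h .{{_ : NonZero b}} .{{_ : NonZero d}} .{{_ : NonZero f}} .{{_ : NonZero h}} →
               (a ℕ.* d ℕ.+ c ℕ.* b) ℕ.* (f ℕ.* h) ℕ.< (e ℕ.* h ℕ.+ g ℕ.* f) ℕ.* (b ℕ.* d) →
               + a / b + + c / d < + e / f + + g / h
  /+/-mono-< a b c d e f g h lt =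
    subst₂ _<_ (sym (/-+ a b c d)) (sym (/-+ e f g h))
      (/-mono-< (a ℕ.* d ℕ.+ c ℕ.* b) (b ℕ.* d) (e ℕ.* h ℕ.+ g ℕ.* f) (f ℕ.* h) {{ℕ.m*n≢0 b d}} {{ℕ.m*n≢0 f h}} lt)

  module _ (f : ℕ → ℚ) where

    monotone-by-steps : (∀ n → f n ≤ f (suc n)) → ∀ {m n} → m ℕ.≤ n → f m ≤ f n
    monotone-by-steps step m≤n = go (ℕ.≤⇒≤′ m≤n)
      where
      go : ∀ {m n} → m ≤′ n → f m ≤ f n
      go ≤′-refl        = ≤-refl
      go (≤′-step m≤′n) = ≤-trans (go m≤′n) (step _)

    antitone-by-steps : (∀ n → f (suc n) ≤ f n) → ∀ {m n} → m ℕ.≤ n → f n ≤ f m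
    antitone-by-steps step m≤n = go (ℕ.≤⇒≤′ m≤n)
      where
      go : ∀ {m n} → m ≤′ n → f n ≤ f m
      go ≤′-refl        = ≤-refl
      go (≤′-step m≤′n) = ≤-trans (step _) (go m≤′n)

  private
    open +-*-Solver

    p-d≡[p+e]-[d+e] : ∀ p d e → p - d ≡ (p + e) - (d + e)
    p-d≡[p+e]-[d+e] = solve 3 (λ p d e → p :- d := (p :+ e) :- (d :+ e)) refl

    q-e≡[q+d]-[d+e] : ∀ q d e → q - e ≡ (q + d) - (d + e)
    q-e≡[q+d]-[d+e] = solve 3 (λ q d e → q :- e := (q :+ d) :- (d :+ e)) refl

    p-[p-d]≡d : ∀ p d → p - (p - d) ≡ d
    p-[p-d]≡d = solve 2 (λ p d → p :- (p :- d) := d) refl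

    -[x-y]≡y-x : ∀ x y → - (x - y) ≡ y - x
    -[x-y]≡y-x = solve 2 (λ x y → :- (x :- y) := y :- x) refl

  p+e≤q+d⇒p-d≤q-e : ∀ {p q d e} → p + e ≤ q + d → p - d ≤ q - e
  p+e≤q+d⇒p-d≤q-e {p} {q} {d} {e} le =
    subst₂ _≤_ (sym (p-d≡[p+e]-[d+e] p d e)) (sym (q-e≡[q+d]-[d+e] q d e)) (+-monoˡ-≤ (- (d + e)) le)

  p+e<q+d⇒p-d<q-e : ∀ {p q d e} → p + e < q + d → p - d < q - e
  p+e<q+d⇒p-d<q-e {p} {q} {d} {e} lt =
    subst₂ _<_ (sym (p-d≡[p+e]-[d+e] p d e)) (sym (q-e≡[q+d]-[d+e] q d e)) (+-monoˡ-< (- (d + e)) lt)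

  x-y≤d : ∀ {a d x y} → x ≤ a → a - d ≤ y → x - y ≤ d
  x-y≤d {a} {d} x≤a a-d≤y = ≤-trans (+-mono-≤ x≤a (neg-antimono-≤ a-d≤y)) (≤-reflexive (p-[p-d]≡d a d))

  ∣x-y∣≤d : ∀ {a d x y} → a - d ≤ x → x ≤ a → a - d ≤ y → y ≤ a → ∣ x - y ∣ ≤ d
  ∣x-y∣≤d {a} {d} {x} {y} a-d≤x x≤a a-d≤y y≤a with ∣p∣≡p∨∣p∣≡-p (x - y)
  ... | inj₁ ∣x-y∣≡x-y = subst (_≤ d) (sym ∣x-y∣≡x-y) (x-y≤d x≤a a-d≤y)
  ... | inj₂ ∣x-y∣≡y-x = subst (_≤ d) (sym (trans ∣x-y∣≡y-x (-[x-y]≡y-x x y))) (x-y≤d y≤a a-d≤x)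

  p-d≤p : ∀ {p d} → 0ℚ ≤ d → p - d ≤ p
  p-d≤p {p} 0≤d = ≤-trans (+-monoʳ-≤ p (neg-antimono-≤ 0≤d)) (≤-reflexive (+-identityʳ p))

module Asymptotics where

  open Combinatorics
  open Rationals
  open import Data.Nat as ℕ using (ℕ; zero; suc; _+_; _*_; _^_; _∸_; z≤n; s≤s; NonZero; ⌊_/2⌋)
  import Data.Nat.Properties as ℕ
  open import Data.Nat.Tactic.RingSolver using (solve-∀)
  open import Data.Integer using (+_; +0; +[1+_]; -[1+_]; +<+)
  open import Data.Rational using (ℚ; mkℚ; *<*; 0ℚ; 1ℚ; _/_; _-_; _≤_; _<_; ∣_∣)
  open import Data.Rational.Properties using (≤-antisym; ≤-<-trans; ↥p/↧p≡p; module ≤-Reasoning)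
  open import Data.Product using (Σ; _,_)
  open import Data.Sum using (_⊎_; inj₁; inj₂; [_,_]′)
  open import Function using (_∘_)
  open import Relation.Binary.PropositionalEquality using (_≡_; refl; sym; trans; cong; subst)

  n<k^n : ∀ {k} → 1 ℕ.< k → ∀ n → n ℕ.< k ^ n
  n<k^n 1<k zero    = s≤s z≤n
  n<k^n 1<k (suc n) = ℕ.≤-<-trans (n<k^n 1<k n) (ℕ.^-monoʳ-< _ 1<k (ℕ.n<1+n n))

  parity : ∀ n → n ≡ ⌊ n /2⌋ + ⌊ n /2⌋ ⊎ n ≡ suc (⌊ n /2⌋ + ⌊ n /2⌋)
  parity zero          = inj₁ refl
  parity (suc zero)    = inj₂ refl
  parity (suc (suc n)) with parity n
  ... | inj₁ e = inj₁ (cong suc (trans (cong suc e) (sym (ℕ.+-suc _ _))))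
  ... | inj₂ e = inj₂ (cong suc (trans (cong suc e) (cong suc (sym (ℕ.+-suc _ _)))))

  module Ratio (j : ℕ) where

    K : ℕ
    K = suc (suc j)

    K^≢0 : ∀ n → NonZero (K ^ n)
    K^≢0 n = ℕ.m^n≢0 K n

    infixl 7 _/K^_
    _/K^_ : ℕ → ℕ → ℚ
    a /K^ n = _/_ (+ a) (K ^ n) {{K^≢0 n}}

    r : ℕ → ℚ
    r = ratio K

    δ : ℕ → ℚ
    δ n = 1 /K^ n

    δ≥0 : ∀ n → 0ℚ ≤ δ n
    δ≥0 n = /-mono-≤ 0 1 1 (K ^ n) {{_}} {{K^≢0 n}} z≤n

    envelope : ℕ → ℚ
    envelope m = r (m + m) - δ (suc m)

    /K^-mono-≤ : ∀ a m c n → a * K ^ n ℕ.≤ c * K ^ m → a /K^ m ≤ c /K^ n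
    /K^-mono-≤ a m c n = /-mono-≤ a (K ^ m) c (K ^ n) {{K^≢0 m}} {{K^≢0 n}}

    r-antitone-step : ∀ n → r (suc n) ≤ r n
    r-antitone-step n = /K^-mono-≤ (s K (suc n)) (suc n) (s K n) n (begin
      s K (suc n) * K ^ n  ≤⟨ ℕ.*-monoˡ-≤ (K ^ n) (s-suc≤ K n) ⟩
      K * s K n * K ^ n    ≡⟨ rearrange K (s K n) (K ^ n) ⟩
      s K n * (K * K ^ n)  ∎)
      where
      open ℕ.≤-Reasoning
      rearrange : ∀ k x p → k * x * p ≡ x * (k * p)
      rearrange = solve-∀

    r-antitone : ∀ {m n} → m ℕ.≤ n → r n ≤ r m
    r-antitone = antitone-by-steps r r-antitone-step

    r-odd : ∀ m → r (suc (m + m)) ≡ r (m + m)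
    r-odd m = ≤-antisym (r-antitone-step (m + m)) (/K^-mono-≤ x (m + m) (s K (suc (m + m))) (suc (m + m)) (begin
      x * (K * K ^ (m + m))            ≡⟨ rearrange x K (K ^ (m + m)) ⟩
      K * x * K ^ (m + m)              ≤⟨ ℕ.*-monoˡ-≤ (K ^ (m + m)) (*s≤s-odd K m) ⟩
      s K (suc (m + m)) * K ^ (m + m)  ∎))
      where
      open ℕ.≤-Reasoning
      x = s K (m + m)
      rearrange : ∀ x k p → x * (k * p) ≡ k * x * p
      rearrange = solve-∀

    -- Not by `with`: that would normalise r n and unfold the enumeration of all words.
    r≡r-even : ∀ n → r n ≡ r (⌊ n /2⌋ + ⌊ n /2⌋)
    r≡r-even n = [ cong r , (λ e → trans (cong r e) (r-odd ⌊ n /2⌋)) ]′ (parity n)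

    envelope-step-cross : ∀ i →
      (s K (1 + i + (1 + i)) * K ^ (3 + i) + 1 * K ^ (1 + i + (1 + i))) * (K ^ (2 + i + (2 + i)) * K ^ (2 + i))
        ℕ.≤ (s K (2 + i + (2 + i)) * K ^ (2 + i) + 1 * K ^ (2 + i + (2 + i))) * (K ^ (1 + i + (1 + i)) * K ^ (3 + i))
    envelope-step-cross i rewrite ℕ.^-distribˡ-+-* K (1 + i) (1 + i) | ℕ.^-distribˡ-+-* K (2 + i) (2 + i) = begin
      (x * (K * (K * P)) + 1 * (P * P)) * (K * P * (K * P) * (K * P))  ≡⟨ lhs K P x ⟩
      C * (K * (K * x) + P)                                            ≤⟨ ℕ.*-monoʳ-≤ C (envelope-step-ℕ K i) ⟩
      C * (y + K * P)                                                  ≡⟨ rhs K P y ⟩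
      (y * (K * P) + 1 * (K * P * (K * P))) * (P * P * (K * (K * P)))  ∎
      where
      open ℕ.≤-Reasoning
      P = K ^ suc i
      x = s K (suc i + suc i)
      y = s K (2 + i + (2 + i))
      C = K * K * K * (P * P * (P * P))
      lhs : ∀ k p x → (x * (k * (k * p)) + 1 * (p * p)) * (k * p * (k * p) * (k * p)) ≡ k * k * k * (p * p * (p * p)) * (k * (k * x) + p)
      lhs = solve-∀
      rhs : ∀ k p y → k * k * k * (p * p * (p * p)) * (y + k * p) ≡ (y * (k * p) + 1 * (k * p * (k * p))) * (p * p * (k * (k * p)))
      rhs = solve-∀

    envelope-step : ∀ i → envelope (suc i) ≤ envelope (suc (suc i))
    envelope-step i = p+e≤q+d⇒p-d≤q-e {r (m + m)} {r (1 + m + (1 + m))} {δ (1 + m)} {δ (2 + m)}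
      (/+/-mono-≤ (s K (m + m)) (K ^ (m + m)) 1 (K ^ (2 + m)) (s K (1 + m + (1 + m))) (K ^ (1 + m + (1 + m))) 1 (K ^ (1 + m))
                  {{K^≢0 (m + m)}} {{K^≢0 (2 + m)}} {{K^≢0 (1 + m + (1 + m))}} {{K^≢0 (1 + m)}}
                  (envelope-step-cross i))
      where m = suc i

    envelope-mono : ∀ {i m} → suc i ℕ.≤ m → envelope (suc i) ≤ envelope m
    envelope-mono {m = suc m} (s≤s i≤m) = monotone-by-steps (envelope ∘ suc) envelope-step i≤m

    envelope≤r : ∀ {i n} → 1 + i + (1 + i) ℕ.≤ n → envelope (suc i) ≤ r n
    envelope≤r {i} {n} 2+2i≤n = begin
      envelope (suc i)       ≤⟨ envelope-mono 1+i≤⌊n/2⌋ ⟩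
      envelope ⌊ n /2⌋       ≤⟨ p-d≤p {r (⌊ n /2⌋ + ⌊ n /2⌋)} (δ≥0 (suc ⌊ n /2⌋)) ⟩
      r (⌊ n /2⌋ + ⌊ n /2⌋)  ≡⟨ r≡r-even n ⟨
      r n                    ∎
      where
      open ≤-Reasoning
      1+i≤⌊n/2⌋ : suc i ℕ.≤ ⌊ n /2⌋
      1+i≤⌊n/2⌋ = subst (ℕ._≤ ⌊ n /2⌋) (sym (ℕ.n≡⌊n+n/2⌋ (suc i))) (ℕ.⌊n/2⌋-mono 2+2i≤n)

    δ-vanishes : ∀ ε → 0ℚ < ε → Σ ℕ λ i → δ (2 + i) < ε
    δ-vanishes (mkℚ +[1+ p ] d _) _ =
      d , subst (δ (2 + d) <_) (↥p/↧p≡p _) (/-mono-< 1 (K ^ (2 + d)) (suc p) (suc d) {{K^≢0 (2 + d)}} (begin-strict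
        1 * suc d            ≡⟨ ℕ.*-identityˡ (suc d) ⟩
        suc d                <⟨ ℕ.n<1+n (suc d) ⟩
        2 + d                <⟨ n<k^n (s≤s (s≤s z≤n)) (2 + d) ⟩
        K ^ (2 + d)          ≤⟨ ℕ.m≤n*m (K ^ (2 + d)) (suc p) ⟩
        suc p * K ^ (2 + d)  ∎))
      where open ℕ.≤-Reasoning
    δ-vanishes (mkℚ +0       _ _) (*<* (+<+ ()))
    δ-vanishes (mkℚ -[1+ _ ] _ _) (*<* ())

    r-cauchy : ∀ ε → 0ℚ < ε → Σ ℕ λ N → ∀ m n → N ℕ.≤ m → N ℕ.≤ n → ∣ r m - r n ∣ < ε
    r-cauchy ε ε>0 = let i , δ<ε = δ-vanishes ε ε>0 in
      1 + i + (1 + i) , λ m n N≤m N≤n →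
        ≤-<-trans (∣x-y∣≤d (envelope≤r N≤m) (r-antitone N≤m) (envelope≤r N≤n) (r-antitone N≤n)) δ<ε

    [K*K+1]*[K∸1]<s₂*[K∸1]+K*K : (K * K + 1) * suc j ℕ.< s K 2 * suc j + K * K
    [K*K+1]*[K∸1]<s₂*[K∸1]+K*K = begin-strict
      (K * K + 1) * suc j            <⟨ ℕ.n<1+n _ ⟩
      suc ((K * K + 1) * suc j)      ≡⟨ e₁ j ⟩
      K * K * suc j + (2 + j)        ≤⟨ ℕ.+-monoˡ-≤ (2 + j) (ℕ.*-monoˡ-≤ (suc j) (ℕ.≤-reflexive (sym (s₂+k≡k*k K)))) ⟩
      (s K 2 + K) * suc j + (2 + j)  ≡⟨ e₂ j (s K 2) ⟩
      s K 2 * suc j + K * K          ∎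
      where
      open ℕ.≤-Reasoning
      e₁ : ∀ j → suc (((2 + j) * (2 + j) + 1) * suc j) ≡ (2 + j) * (2 + j) * suc j + (2 + j)
      e₁ = solve-∀
      e₂ : ∀ j σ → (σ + (2 + j)) * suc j + (2 + j) ≡ σ * suc j + (2 + j) * (2 + j)
      e₂ = solve-∀

    1-1/[K∸1]<envelope-1 : 1ℚ - + 1 / (K ∸ 1) < envelope 1
    1-1/[K∸1]<envelope-1 = p+e<q+d⇒p-d<q-e {1ℚ} {r 2} {+ 1 / suc j} {δ 2}
      (/+/-mono-< 1 1 1 (K ^ 2) (s K 2) (K ^ 2) 1 (suc j) {{_}} {{K^≢0 2}} {{K^≢0 2}} (begin-strict
        (1 * K ^ 2 + 1 * 1) * (K ^ 2 * suc j)      ≡⟨ e₁ K (suc j) ⟩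
        K ^ 2 * ((K * K + 1) * suc j)              <⟨ ℕ.*-monoʳ-< (K ^ 2) {{K^≢0 2}} [K*K+1]*[K∸1]<s₂*[K∸1]+K*K ⟩
        K ^ 2 * (s K 2 * suc j + K * K)            ≡⟨ e₂ K (suc j) (s K 2) ⟩
        (s K 2 * suc j + 1 * K ^ 2) * (1 * K ^ 2)  ∎))
      where
      open ℕ.≤-Reasoning
      e₁ : ∀ k J → (1 * (k * (k * 1)) + 1 * 1) * (k * (k * 1) * J) ≡ k * (k * 1) * ((k * k + 1) * J)
      e₁ = solve-∀
      e₂ : ∀ k J σ → k * (k * 1) * (σ * J + k * k) ≡ (σ * J + 1 * (k * (k * 1))) * (1 * (k * (k * 1)))
      e₂ = solve-∀

open import Data.Nat using (ℕ; suc; _≤_; _∸_)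
open import Data.Integer using (+_)
open import Data.Rational using (ℚ; _/_; _-_; _<_; 0ℚ; 1ℚ; ∣_∣) renaming (_≤_ to _≤ℚ_)
open import Data.Product using (Σ; _×_; _,_)

theorem15 : (j : ℕ) →
    (((ε : ℚ) → 0ℚ < ε → Σ ℕ λ N → (m n : ℕ) → N ≤ m → N ≤ n →
        ∣ ratio (suc (suc j)) m - ratio (suc (suc j)) n ∣ < ε)
    × (Σ ℚ λ q → (1ℚ - (+ 1) / (suc (suc j) ∸ 1)) < q ×
        Σ ℕ λ N → (n : ℕ) → N ≤ n → q ≤ℚ ratio (suc (suc j)) n))
theorem15 j = r-cauchy , envelope 1 , 1-1/[K∸1]<envelope-1 , 2 , λ n → envelope≤r {0}
  where open Asymptotics.Ratio j
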